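{- Let $R=k[x,y,z]$ and let $I$ be a monomial ideal such that $R/I$ is Artinian and level of type $2$. Then, up to a permutation of the variables, $I$ has one of the following two forms: (a) $I=(x^a,y^b,z^c,y^\beta z^\gamma)$ with $b-\beta=c-\gamma$; in this case the Hilbert function of $R/I$ is $H(a,b-\beta,\gamma)(-\beta)+H(a,\beta,c)$; (b) $I=(x^a,y^b,z^c,x^\alpha y^\beta,x^\alpha z^\gamma)$ with $a-\alpha=(b-\beta)+(c-\gamma)$ (in particular one may assume $a>\alpha$); in this case the Hilbert function of $R/I$ is $H(a-\alpha,\beta,\gamma)(-\alpha)+H(\alpha,b,c)$. Conversely, for positive integers with $\beta<b$, $\gamma<c$ (and $\alpha<a$ in the second case), any Hilbert function $\underline H$ that can be written as $\underline H=H(a,b-\beta,\gamma)(-\beta)+H(a,\beta,c)$ with $b-\beta=c-\gamma$, or as $\underline H=H(a-\alpha,\beta,\gamma)(-\alpha)+H(\alpha,b,c)$ with $a-\alpha=(b-\beta)+(c-\gamma)$, is a pure $O$-sequence.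
   Context: $k$ is an infinite field. For positive integers $a,b,c$, $H(a,b,c)$ denotes the Hilbert function $j\mapsto\dim_k[R/(x^a,y^b,z^c)]_j$, and $H(a,b,c)(-s)$ denotes the shifted function $j\mapsto H(a,b,c)(j-s)$. A standard graded Artinian algebra is level of type $t$ if its socle (annihilator of the homogeneous maximal ideal) has dimension $t$ and is concentrated in a single degree. A pure $O$-sequence is the Hilbert function of a monomial Artinian level algebra; equivalently the vector counting by degree the monomials of a finite set of monomials closed under divisors whose maximal elements all have the same degree. -}

module Defs where

-- A monomial x^i y^j z^l is represented by its exponent triple (i , j , l).
-- A monomial ideal is given by a finite list of monomial generators
-- (every monomial ideal of R is finitely generated, Dickson's lemma).

open import Data.Nat using (ℕ; zero; suc; _+_; _∸_; _<_; _<?_; _≤_; _≤?_; _≟_)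
open import Data.Product using (Σ; _×_; _,_; proj₁; proj₂)
open import Data.Sum using (_⊎_)
open import Data.List using (List; []; _∷_; length; filter; concatMap; upTo; map)
open import Data.List.Relation.Unary.Any using (Any; any?)
open import Data.List.Membership.Propositional using (_∈_)
open import Data.List.Relation.Unary.Unique.Propositional using (Unique)
open import Relation.Nullary using (¬_; Dec; yes; no)
open import Relation.Nullary.Decidable using (_×-dec_; ¬?)
open import Relation.Binary.PropositionalEquality using (_≡_; _≢_)
open import Function.Bundles using (_⇔_)

Mon : Set
Mon = ℕ × ℕ × ℕ

deg : Mon → ℕ
deg (i , j , l) = i + j + l

_∣ₘ_ : Mon → Mon → Set
(i , j , l) ∣ₘ (i' , j' , l') = (i ≤ i') × (j ≤ j') × (l ≤ l')

_∣ₘ?_ : (m n : Mon) → Dec (m ∣ₘ n)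
(i , j , l) ∣ₘ? (i' , j' , l') = (i ≤? i') ×-dec ((j ≤? j') ×-dec (l ≤? l'))

xm ym zm : Mon → Mon
xm (i , j , l) = (suc i , j , l)
ym (i , j , l) = (i , suc j , l)
zm (i , j , l) = (i , j , suc l)

InIdeal : List Mon → Mon → Set
InIdeal gens m = Any (λ g → g ∣ₘ m) gens

inIdeal? : (gens : List Mon) → (m : Mon) → Dec (InIdeal gens m)
inIdeal? gens m = any? (λ g → g ∣ₘ? m) gens

-- equality of monomial ideals (as sets of monomials, hence as ideals)
SameIdeal : List Mon → List Mon → Set
SameIdeal g h = ∀ m → InIdeal g m ⇔ InIdeal h m

-- standard monomials: those not in I; they form a k-basis of R/I
Standard : List Mon → Mon → Set
Standard gens m = ¬ InIdeal gens m

-- R/I Artinian: R/I finite dimensional, i.e. finitely many standard monomials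
Artinian : List Mon → Set
Artinian gens = Σ ℕ λ N → ∀ m → Standard gens m →
  (proj₁ m < N) × (proj₁ (proj₂ m) < N) × (proj₂ (proj₂ m) < N)

-- socle monomials of R/I: standard monomials m with x m, y m, z m ∈ I;
-- the socle of R/I (I monomial) is the k-span of these monomials.
Socle : List Mon → Mon → Set
Socle gens m = Standard gens m × InIdeal gens (xm m) × InIdeal gens (ym m) × InIdeal gens (zm m)

-- R/I is Artinian and level of type 2: socle of dimension 2 (exactly two
-- distinct socle monomials) concentrated in a single degree.
ArtinianLevelType2 : List Mon → Set
ArtinianLevelType2 gens = Artinian gens ×
  (Σ Mon λ s₁ → Σ Mon λ s₂ → (s₁ ≢ s₂) × Socle gens s₁ × Socle gens s₂ ×
     (deg s₁ ≡ deg s₂) × (∀ s → Socle gens s → (s ≡ s₁) ⊎ (s ≡ s₂)))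

monsOfDeg : ℕ → List Mon
monsOfDeg d = concatMap (λ i → map (λ j → (i , j , d ∸ i ∸ j)) (upTo (suc (d ∸ i)))) (upTo (suc d))

HF : List Mon → ℕ → ℕ
HF gens d = length (filter (λ m → ¬? (inIdeal? gens m)) (monsOfDeg d))

-- H(a,b,c)(d) = dim_k [R/(x^a,y^b,z^c)]_d
--             = number of monomials x^i y^j z^l of degree d with i<a, j<b, l<c
H : ℕ → ℕ → ℕ → ℕ → ℕ
H a b c d = length (filter (λ m → (proj₁ m <? a) ×-dec ((proj₁ (proj₂ m) <? b) ×-dec (proj₂ (proj₂ m) <? c))) (monsOfDeg d))

-- shifted function f(-s) : j ↦ f(j - s)  (zero for j < s)
shift : (ℕ → ℕ) → ℕ → ℕ → ℕ
shift f s j with j <? s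
... | yes _ = 0
... | no _ = f (j ∸ s)

data Perm3 : Set where
  pxyz pxzy pyxz pyzx pzxy pzyx : Perm3

perm : Perm3 → Mon → Mon
perm pxyz (i , j , l) = (i , j , l)
perm pxzy (i , j , l) = (i , l , j)
perm pyxz (i , j , l) = (j , i , l)
perm pyzx (i , j , l) = (j , l , i)
perm pzxy (i , j , l) = (l , i , j)
perm pzyx (i , j , l) = (l , j , i)

formA : ℕ → ℕ → ℕ → ℕ → ℕ → List Mon
formA a b c β γ = (a , 0 , 0) ∷ (0 , b , 0) ∷ (0 , 0 , c) ∷ (0 , β , γ) ∷ []

formB : ℕ → ℕ → ℕ → ℕ → ℕ → ℕ → List Mon
formB a b c α β γ = (a , 0 , 0) ∷ (0 , b , 0) ∷ (0 , 0 , c) ∷ (α , β , 0) ∷ (α , 0 , γ) ∷ []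

MaximalIn : List Mon → Mon → Set
MaximalIn L m = (m ∈ L) × ¬ (xm m ∈ L) × ¬ (ym m ∈ L) × ¬ (zm m ∈ L)

PureOSequence : (ℕ → ℕ) → Set
PureOSequence h = Σ (List Mon) λ L → Unique L ×
  (∀ m n → n ∈ L → m ∣ₘ n → m ∈ L) ×
  (∀ m n → MaximalIn L m → MaximalIn L n → deg m ≡ deg n) ×
  (∀ d → h d ≡ length (filter (λ m → deg m ≟ d) L))

-- The standard monomials of a monomial ideal I (those outside I) are closed under division, and
-- when R/I is Artinian every standard monomial divides a socle monomial: multiply by variables
-- while staying outside I.  So R/I is level of type 2 exactly when its standard monomials are the
-- divisors of two distinct monomials s₁, s₂ of the same degree.  Such monomials are incomparable
-- under division, hence s₁ exceeds s₂ in some exponent and falls short in another; up to a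
-- permutation of the variables this leaves two sign patterns, and they are precisely the socles of
-- the ideals (a) and (b).  The divisors of s₁, s₂ split into two disjoint boxes, one of them
-- translated by y^β resp. x^α, which gives the Hilbert function as a sum of two (shifted) H's.
-- Conversely, for the ideals (a) and (b) the same divisor sets witness that this sum is a pure
-- O-sequence.

module Submission where

open import Defs
open import Data.Nat
open import Data.Nat.Properties
open import Data.Nat.Solver using (module +-*-Solver)
open import Data.Product using (Σ; _×_; _,_; proj₁; proj₂)
open import Data.Sum using (_⊎_; inj₁; inj₂; swap) renaming (map to map-⊎)
open import Data.Empty using (⊥-elim)
open import Data.List using (List; []; _∷_; length; filter; concatMap; upTo; map)
open import Data.List.Properties using (length-map; filter-≐)
open import Data.List.Membership.Propositional using (_∈_; find; lose)
open import Data.List.Membership.Propositional.Properties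
  using (∈-map⁺; ∈-map⁻; ∈-filter⁺; ∈-filter⁻; ∈-concatMap⁺; ∈-concatMap⁻; ∈-upTo⁺; ∈-upTo⁻)
open import Data.List.Membership.Propositional.Properties.WithK using (unique∧set⇒bag)
open import Data.List.Relation.Unary.Any using (here; there)
import Data.List.Relation.Unary.Any as Any
import Data.List.Relation.Unary.Any.Properties as Any
open import Data.List.Relation.Unary.All using ([]; _∷_)
import Data.List.Relation.Unary.All as All
import Data.List.Relation.Unary.All.Properties as All
open import Data.List.Relation.Unary.All.Properties using (All¬⇒¬Any)
import Data.List.Relation.Unary.AllPairs as AllPairs
import Data.List.Relation.Unary.AllPairs.Properties as AllPairs
open import Data.List.Relation.Unary.Unique.Propositional using (Unique)
import Data.List.Relation.Unary.Unique.Propositional.Properties as Unique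
open import Data.List.Relation.Binary.BagAndSetEquality using (∼bag⇒↭)
open import Data.List.Relation.Binary.Permutation.Propositional.Properties using (↭-length)
open import Function using (_∘_)
open import Function.Bundles using (_⇔_; mk⇔; Equivalence)
import Function.Properties.Equivalence as ⇔
open import Level using (0ℓ)
open import Relation.Binary using (tri<; tri≈; tri>)
open import Relation.Binary.PropositionalEquality
open import Relation.Nullary using (¬_; Dec; yes; no; contradiction)
open import Relation.Nullary.Decidable using (_⊎-dec_; _×-dec_; ¬?; decidable-stable)
open import Relation.Unary using (Pred; Decidable)

open +-*-Solver using (solve; _:+_; _:=_)

∣ₘ-refl : ∀ m → m ∣ₘ m
∣ₘ-refl m = ≤-refl , ≤-refl , ≤-refl

∣ₘ-trans : ∀ {m n o} → m ∣ₘ n → n ∣ₘ o → m ∣ₘ o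
∣ₘ-trans (i≤ , j≤ , l≤) (i≤′ , j≤′ , l≤′) = ≤-trans i≤ i≤′ , ≤-trans j≤ j≤′ , ≤-trans l≤ l≤′

_+ₘ_ : Mon → Mon → Mon
(i , j , l) +ₘ (i′ , j′ , l′) = (i + i′ , j + j′ , l + l′)

_-ₘ_ : Mon → Mon → Mon
(i , j , l) -ₘ (i′ , j′ , l′) = (i ∸ i′ , j ∸ j′ , l ∸ l′)

deg-+ₘ : ∀ m n → deg (m +ₘ n) ≡ deg m + deg n
deg-+ₘ (i , j , l) (i′ , j′ , l′) =
  solve 6 (λ i j l i′ j′ l′ → (i :+ i′) :+ (j :+ j′) :+ (l :+ l′) := (i :+ j :+ l) :+ (i′ :+ j′ :+ l′))
    refl i j l i′ j′ l′

-ₘ-+ₘ : ∀ {v m} → v ∣ₘ m → (m -ₘ v) +ₘ v ≡ m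
-ₘ-+ₘ {i′ , j′ , l′} {i , j , l} (i′≤i , j′≤j , l′≤l)
  rewrite m∸n+n≡m i′≤i | m∸n+n≡m j′≤j | m∸n+n≡m l′≤l = refl

+ₘ-ₘ : ∀ m v → (m +ₘ v) -ₘ v ≡ m
+ₘ-ₘ (i , j , l) (i′ , j′ , l′) rewrite m+n∸n≡m i i′ | m+n∸n≡m j j′ | m+n∸n≡m l l′ = refl

∣ₘ-+ₘ : ∀ m v → v ∣ₘ (m +ₘ v)
∣ₘ-+ₘ (i , j , l) (i′ , j′ , l′) = m≤n+m i′ i , m≤n+m j′ j , m≤n+m l′ l

∣ₘ⇒deg≤ : ∀ {v m} → v ∣ₘ m → deg v ≤ deg m
∣ₘ⇒deg≤ {v} {m} v∣m = begin
  deg v                   ≤⟨ m≤n+m (deg v) (deg (m -ₘ v)) ⟩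
  deg (m -ₘ v) + deg v    ≡⟨ deg-+ₘ (m -ₘ v) v ⟨
  deg ((m -ₘ v) +ₘ v)     ≡⟨ cong deg (-ₘ-+ₘ v∣m) ⟩
  deg m                   ∎
  where open ≤-Reasoning

∣ₘ∧deg≡⇒≡ : ∀ {m n} → m ∣ₘ n → deg m ≡ deg n → m ≡ n
∣ₘ∧deg≡⇒≡ (i≤ , j≤ , l≤) deg≡ with m≤n⇒m<n∨m≡n i≤ | m≤n⇒m<n∨m≡n j≤ | m≤n⇒m<n∨m≡n l≤
... | inj₁ i< | _         | _         = contradiction deg≡ (<⇒≢ (+-mono-<-≤ (+-mono-<-≤ i< j≤) l≤))
... | inj₂ refl | inj₁ j< | _         = contradiction deg≡ (<⇒≢ (+-mono-<-≤ (+-mono-≤-< ≤-refl j<) l≤))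
... | inj₂ refl | inj₂ refl | inj₁ l< = contradiction deg≡ (<⇒≢ (+-mono-≤-< ≤-refl l<))
... | inj₂ refl | inj₂ refl | inj₂ refl = refl

incomparable : ∀ {m n} → deg m ≡ deg n → m ≢ n → ¬ (m ∣ₘ n ⊎ n ∣ₘ m)
incomparable deg≡ m≢n (inj₁ m∣n) = m≢n (∣ₘ∧deg≡⇒≡ m∣n deg≡)
incomparable deg≡ m≢n (inj₂ n∣m) = m≢n (sym (∣ₘ∧deg≡⇒≡ n∣m (sym deg≡)))

-- Counting monomials of a fixed degree

length-≡-unique : ∀ {A : Set} {xs ys : List A} → Unique xs → Unique ys →
  (∀ {x} → x ∈ xs → x ∈ ys) → (∀ {x} → x ∈ ys → x ∈ xs) → length xs ≡ length ys
length-≡-unique u v to from = ↭-length (∼bag⇒↭ (unique∧set⇒bag u v (mk⇔ to from)))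

monsOfDegWithX : ℕ → ℕ → List Mon
monsOfDegWithX d i = map (λ j → (i , j , d ∸ i ∸ j)) (upTo (suc (d ∸ i)))

∈-monsOfDeg⁻ : ∀ {d m} → m ∈ monsOfDeg d → deg m ≡ d
∈-monsOfDeg⁻ {d} m∈ with i , i∈ , m∈slice ← find (∈-concatMap⁻ (monsOfDegWithX d) {xs = upTo (suc d)} m∈)
                    with j , j∈ , refl ← ∈-map⁻ (λ j → (i , j , d ∸ i ∸ j)) m∈slice = begin
  i + j + (d ∸ i ∸ j)     ≡⟨ +-assoc i j _ ⟩
  i + (j + (d ∸ i ∸ j))   ≡⟨ cong (i +_) (m+[n∸m]≡n (s≤s⁻¹ (∈-upTo⁻ j∈))) ⟩
  i + (d ∸ i)             ≡⟨ m+[n∸m]≡n (s≤s⁻¹ (∈-upTo⁻ i∈)) ⟩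
  d                       ∎
  where open ≡-Reasoning

∈-monsOfDeg⁺ : ∀ {d m} → deg m ≡ d → m ∈ monsOfDeg d
∈-monsOfDeg⁺ {d} {i , j , l} refl =
  ∈-concatMap⁺ (monsOfDegWithX d) {xs = upTo (suc d)}
    (lose (∈-upTo⁺ (s≤s (≤-trans (m≤m+n i j) (m≤m+n (i + j) l)))) (subst (_∈ monsOfDegWithX d i) third≡ m∈slice))
  where
  d∸i≡ : d ∸ i ≡ j + l
  d∸i≡ = trans (cong (_∸ i) (+-assoc i j l)) (m+n∸m≡n i (j + l))
  third≡ : (i , j , d ∸ i ∸ j) ≡ (i , j , l)
  third≡ = cong (λ t → (i , j , t)) (trans (cong (_∸ j) d∸i≡) (m+n∸m≡n j l))
  m∈slice : (i , j , d ∸ i ∸ j) ∈ monsOfDegWithX d i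
  m∈slice = ∈-map⁺ (λ j → (i , j , d ∸ i ∸ j)) (∈-upTo⁺ (s≤s (subst (j ≤_) (sym d∸i≡) (m≤m+n j l))))

monsOfDeg-unique : ∀ d → Unique (monsOfDeg d)
monsOfDeg-unique d =
  Unique.concat⁺ (All.map⁺ (All.universal (λ i → Unique.map⁺ (cong (proj₁ ∘ proj₂)) (Unique.upTo⁺ _)) _))
                 (AllPairs.map⁺ (AllPairs.map slices-disjoint (Unique.upTo⁺ (suc d))))
  where
  first : ∀ {i m} → m ∈ monsOfDegWithX d i → proj₁ m ≡ i
  first {i} m∈ with _ , _ , refl ← ∈-map⁻ (λ j → (i , j , d ∸ i ∸ j)) m∈ = refl
  slices-disjoint : ∀ {i k} → i ≢ k → ∀ {m} → ¬ (m ∈ monsOfDegWithX d i × m ∈ monsOfDegWithX d k)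
  slices-disjoint i≢k (m∈i , m∈k) = i≢k (trans (sym (first m∈i)) (first m∈k))

count : {P : Pred Mon 0ℓ} → Decidable P → ℕ → ℕ
count P? d = length (filter P? (monsOfDeg d))

count-cong : {P Q : Pred Mon 0ℓ} (P? : Decidable P) (Q? : Decidable Q) →
  (∀ m → P m ⇔ Q m) → ∀ d → count P? d ≡ count Q? d
count-cong P? Q? P⇔Q d =
  cong length (filter-≐ P? Q? ((λ {m} → Equivalence.to (P⇔Q m)) , (λ {m} → Equivalence.from (P⇔Q m))) (monsOfDeg d))

count-bijection : {P Q : Pred Mon 0ℓ} (P? : Decidable P) (Q? : Decidable Q) (d e : ℕ) (f : Mon → Mon) →
  (∀ {m n} → f m ≡ f n → m ≡ n) →
  (∀ m → deg m ≡ d → P m → Σ Mon λ n → deg n ≡ e × Q n × f n ≡ m) →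
  (∀ n → deg n ≡ e → Q n → deg (f n) ≡ d × P (f n)) →
  count P? d ≡ count Q? e
count-bijection P? Q? d e f f-injective onto into = begin
  count P? d                                 ≡⟨ length-≡-unique (Unique.filter⁺ P? (monsOfDeg-unique d))
                                                  (Unique.map⁺ f-injective (Unique.filter⁺ Q? (monsOfDeg-unique e)))
                                                  to from ⟩
  length (map f (filter Q? (monsOfDeg e)))   ≡⟨ length-map f (filter Q? (monsOfDeg e)) ⟩
  count Q? e                                 ∎
  where
  open ≡-Reasoning
  to : ∀ {m} → m ∈ filter P? (monsOfDeg d) → m ∈ map f (filter Q? (monsOfDeg e))
  to {m} m∈ with m∈d , Pm ← ∈-filter⁻ P? m∈ with n , deg-n , Qn , refl ← onto m (∈-monsOfDeg⁻ m∈d) Pm =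
    ∈-map⁺ f (∈-filter⁺ Q? (∈-monsOfDeg⁺ deg-n) Qn)
  from : ∀ {m} → m ∈ map f (filter Q? (monsOfDeg e)) → m ∈ filter P? (monsOfDeg d)
  from m∈ with n , n∈ , refl ← ∈-map⁻ f m∈ with n∈e , Qn ← ∈-filter⁻ Q? n∈ with deg-fn , Pfn ← into n (∈-monsOfDeg⁻ n∈e) Qn =
    ∈-filter⁺ P? (∈-monsOfDeg⁺ deg-fn) Pfn

count-empty : {P : Pred Mon 0ℓ} (P? : Decidable P) (d : ℕ) → (∀ m → deg m ≡ d → ¬ P m) → count P? d ≡ 0
count-empty P? d none = length-≡-unique (Unique.filter⁺ P? (monsOfDeg-unique d)) AllPairs.[] to (λ ())
  where
  to : ∀ {m} → m ∈ filter P? (monsOfDeg d) → m ∈ []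
  to m∈ with m∈d , Pm ← ∈-filter⁻ P? m∈ = ⊥-elim (none _ (∈-monsOfDeg⁻ m∈d) Pm)

length-filter-⊎ : {P Q : Pred Mon 0ℓ} (P? : Decidable P) (Q? : Decidable Q) → (∀ m → P m → ¬ Q m) →
  ∀ ms → length (filter (λ m → P? m ⊎-dec Q? m) ms) ≡ length (filter P? ms) + length (filter Q? ms)
length-filter-⊎ P? Q? disjoint [] = refl
length-filter-⊎ P? Q? disjoint (m ∷ ms) with P? m | Q? m
... | yes Pm | yes Qm = ⊥-elim (disjoint m Pm Qm)
... | yes _  | no _   = cong suc (length-filter-⊎ P? Q? disjoint ms)
... | no _   | yes _  = trans (cong suc (length-filter-⊎ P? Q? disjoint ms)) (sym (+-suc _ _))
... | no _   | no _   = length-filter-⊎ P? Q? disjoint ms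

count-⊎ : {P Q : Pred Mon 0ℓ} (P? : Decidable P) (Q? : Decidable Q) → (∀ m → P m → ¬ Q m) →
  ∀ d → count (λ m → P? m ⊎-dec Q? m) d ≡ count P? d + count Q? d
count-⊎ P? Q? disjoint d = length-filter-⊎ P? Q? disjoint (monsOfDeg d)

Shifted : Mon → Pred Mon 0ℓ → Pred Mon 0ℓ
Shifted v P m = v ∣ₘ m × P (m -ₘ v)

shifted? : {P : Pred Mon 0ℓ} → (v : Mon) → Decidable P → Decidable (Shifted v P)
shifted? v P? m = (v ∣ₘ? m) ×-dec P? (m -ₘ v)

count-shifted : {P : Pred Mon 0ℓ} (P? : Decidable P) (v : Mon) →
  ∀ d → count (shifted? v P?) d ≡ shift (count P?) (deg v) d
count-shifted {P} P? v d with d <? deg v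
... | yes d<v = count-empty (shifted? v P?) d λ m deg-m (v∣m , _) → <⇒≱ d<v (subst (deg v ≤_) deg-m (∣ₘ⇒deg≤ v∣m))
... | no d≮v  = count-bijection (shifted? v P?) P? d (d ∸ deg v) (_+ₘ v) +ₘv-injective onto into
  where
  +ₘv-injective : ∀ {m n} → m +ₘ v ≡ n +ₘ v → m ≡ n
  +ₘv-injective {m} {n} eq = trans (sym (+ₘ-ₘ m v)) (trans (cong (_-ₘ v) eq) (+ₘ-ₘ n v))
  onto : ∀ m → deg m ≡ d → Shifted v P m → Σ Mon λ n → deg n ≡ d ∸ deg v × P n × n +ₘ v ≡ m
  onto m deg-m (v∣m , Pm-v) = m -ₘ v , deg≡ , Pm-v , -ₘ-+ₘ v∣m
    where
    deg≡ : deg (m -ₘ v) ≡ d ∸ deg v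
    deg≡ = trans (sym (m+n∸n≡m (deg (m -ₘ v)) (deg v)))
                 (cong (_∸ deg v) (trans (sym (deg-+ₘ (m -ₘ v) v)) (trans (cong deg (-ₘ-+ₘ v∣m)) deg-m)))
  into : ∀ n → deg n ≡ d ∸ deg v → P n → deg (n +ₘ v) ≡ d × Shifted v P (n +ₘ v)
  into n deg-n Pn = trans (deg-+ₘ n v) (trans (cong (_+ deg v) deg-n) (m∸n+n≡m (≮⇒≥ d≮v))) ,
                    ∣ₘ-+ₘ n v , subst P (sym (+ₘ-ₘ n v)) Pn

-- Permuting the variables

inverse : Perm3 → Perm3
inverse pyzx = pzxy
inverse pzxy = pyzx
inverse σ    = σ

perm-inverseˡ : ∀ σ m → perm (inverse σ) (perm σ m) ≡ m
perm-inverseˡ pxyz _ = refl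
perm-inverseˡ pxzy _ = refl
perm-inverseˡ pyxz _ = refl
perm-inverseˡ pyzx _ = refl
perm-inverseˡ pzxy _ = refl
perm-inverseˡ pzyx _ = refl

perm-inverseʳ : ∀ σ m → perm σ (perm (inverse σ) m) ≡ m
perm-inverseʳ pxyz _ = refl
perm-inverseʳ pxzy _ = refl
perm-inverseʳ pyxz _ = refl
perm-inverseʳ pyzx _ = refl
perm-inverseʳ pzxy _ = refl
perm-inverseʳ pzyx _ = refl

perm-injective : ∀ σ {m n} → perm σ m ≡ perm σ n → m ≡ n
perm-injective σ {m} {n} eq = trans (sym (perm-inverseˡ σ m)) (trans (cong (perm (inverse σ)) eq) (perm-inverseˡ σ n))

deg-perm : ∀ σ m → deg (perm σ m) ≡ deg m
deg-perm pxyz (i , j , l) = refl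
deg-perm pxzy (i , j , l) = solve 3 (λ i j l → i :+ l :+ j := i :+ j :+ l) refl i j l
deg-perm pyxz (i , j , l) = solve 3 (λ i j l → j :+ i :+ l := i :+ j :+ l) refl i j l
deg-perm pyzx (i , j , l) = solve 3 (λ i j l → j :+ l :+ i := i :+ j :+ l) refl i j l
deg-perm pzxy (i , j , l) = solve 3 (λ i j l → l :+ i :+ j := i :+ j :+ l) refl i j l
deg-perm pzyx (i , j , l) = solve 3 (λ i j l → l :+ j :+ i := i :+ j :+ l) refl i j l

perm-∣ₘ : ∀ σ {m n} → m ∣ₘ n → perm σ m ∣ₘ perm σ n
perm-∣ₘ pxyz {_ , _ , _} {_ , _ , _} (i≤ , j≤ , l≤) = i≤ , j≤ , l≤
perm-∣ₘ pxzy {_ , _ , _} {_ , _ , _} (i≤ , j≤ , l≤) = i≤ , l≤ , j≤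
perm-∣ₘ pyxz {_ , _ , _} {_ , _ , _} (i≤ , j≤ , l≤) = j≤ , i≤ , l≤
perm-∣ₘ pyzx {_ , _ , _} {_ , _ , _} (i≤ , j≤ , l≤) = j≤ , l≤ , i≤
perm-∣ₘ pzxy {_ , _ , _} {_ , _ , _} (i≤ , j≤ , l≤) = l≤ , i≤ , j≤
perm-∣ₘ pzyx {_ , _ , _} {_ , _ , _} (i≤ , j≤ , l≤) = l≤ , j≤ , i≤

perm-∣ₘ⇔ : ∀ σ m n → perm σ m ∣ₘ perm σ n ⇔ m ∣ₘ n
perm-∣ₘ⇔ σ m n = mk⇔ reflect (perm-∣ₘ σ)
  where
  reflect : perm σ m ∣ₘ perm σ n → m ∣ₘ n
  reflect σm∣σn = subst₂ _∣ₘ_ (perm-inverseˡ σ m) (perm-inverseˡ σ n) (perm-∣ₘ (inverse σ) σm∣σn)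

InIdeal-perm : ∀ σ F n → InIdeal (map (perm σ) F) (perm σ n) ⇔ InIdeal F n
InIdeal-perm σ F n = mk⇔
  (λ σn∈ → Any.map (λ {g} → Equivalence.to (perm-∣ₘ⇔ σ g n)) (Any.map⁻ σn∈))
  (λ n∈ → Any.map⁺ (Any.map (perm-∣ₘ σ) n∈))

HF-perm : ∀ σ F d → HF (map (perm σ) F) d ≡ HF F d
HF-perm σ F d = count-bijection (λ m → ¬? (inIdeal? (map (perm σ) F) m)) (λ m → ¬? (inIdeal? F m))
  d d (perm σ) (perm-injective σ) onto into
  where
  onto : ∀ m → deg m ≡ d → Standard (map (perm σ) F) m → Σ Mon λ n → deg n ≡ d × Standard F n × perm σ n ≡ m
  onto m deg-m m∉ = perm (inverse σ) m , trans (deg-perm (inverse σ) m) deg-m ,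
    (λ n∈ → m∉ (subst (InIdeal _) (perm-inverseʳ σ m) (Equivalence.from (InIdeal-perm σ F _) n∈))) ,
    perm-inverseʳ σ m
  into : ∀ n → deg n ≡ d → Standard F n → deg (perm σ n) ≡ d × Standard (map (perm σ) F) (perm σ n)
  into n deg-n n∉ = trans (deg-perm σ n) deg-n , n∉ ∘ Equivalence.to (InIdeal-perm σ F n)

SameIdeal⇒HF≡ : ∀ {F G} → SameIdeal F G → ∀ d → HF F d ≡ HF G d
SameIdeal⇒HF≡ {F} {G} F≈G = count-cong (λ m → ¬? (inIdeal? F m)) (λ m → ¬? (inIdeal? G m))
  λ m → mk⇔ (λ m∉F m∈G → m∉F (Equivalence.from (F≈G m) m∈G)) (λ m∉G m∈F → m∉G (Equivalence.to (F≈G m) m∈F))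

-- Standard monomials are the divisors of the socle monomials

Below : Mon → Mon → Pred Mon 0ℓ
Below t₁ t₂ n = n ∣ₘ t₁ ⊎ n ∣ₘ t₂

Below-perm : ∀ σ t₁ t₂ n → Below (perm σ t₁) (perm σ t₂) (perm σ n) ⇔ Below t₁ t₂ n
Below-perm σ t₁ t₂ n = mk⇔
  (map-⊎ (Equivalence.to (perm-∣ₘ⇔ σ n t₁)) (Equivalence.to (perm-∣ₘ⇔ σ n t₂)))
  (map-⊎ (perm-∣ₘ σ) (perm-∣ₘ σ))

Below-swap : ∀ t₁ t₂ n → Below t₁ t₂ n ⇔ Below t₂ t₁ n
Below-swap t₁ t₂ n = mk⇔ swap swap

Standard-downward : ∀ gens {m n} → m ∣ₘ n → Standard gens n → Standard gens m
Standard-downward gens m∣n n∉ m∈ = n∉ (Any.map (λ g∣m → ∣ₘ-trans g∣m m∣n) m∈)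

standard⇒∣ₘ-socle : ∀ gens → Artinian gens → ∀ m → Standard gens m → Σ Mon λ s → Socle gens s × m ∣ₘ s
standard⇒∣ₘ-socle gens (N , bounded) m m∉ = climb (N + N + N) m m∉ (m≤n+m (N + N + N) (deg m))
  where
  deg< : ∀ m → Standard gens m → deg m < N + N + N
  deg< m m∉ with i<N , j<N , l<N ← bounded m m∉ = +-mono-< (+-mono-< i<N j<N) l<N
  -- k is fuel: each step raises the degree, and standard monomials have degree below 3N
  climb : ∀ k m → Standard gens m → N + N + N ≤ deg m + k → Σ Mon λ s → Socle gens s × m ∣ₘ s
  climb zero m m∉ 3N≤ = ⊥-elim (<⇒≱ (deg< m m∉) (subst (N + N + N ≤_) (+-identityʳ (deg m)) 3N≤))
  climb (suc k) m@(i , j , l) m∉ 3N≤ = step (inIdeal? gens (xm m)) (inIdeal? gens (ym m)) (inIdeal? gens (zm m))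
    where
    via : ∀ n → Standard gens n → m ∣ₘ n → deg n ≡ suc (deg m) → Σ Mon λ s → Socle gens s × m ∣ₘ s
    via n n∉ m∣n deg-n with s , socle , n∣s ← climb k n n∉ (subst (N + N + N ≤_) (trans (+-suc (deg m) k) (cong (_+ k) (sym deg-n))) 3N≤) =
      s , socle , ∣ₘ-trans m∣n n∣s
    step : Dec (InIdeal gens (xm m)) → Dec (InIdeal gens (ym m)) → Dec (InIdeal gens (zm m)) →
      Σ Mon λ s → Socle gens s × m ∣ₘ s
    step (yes xm∈) (yes ym∈) (yes zm∈) = m , (m∉ , xm∈ , ym∈ , zm∈) , ∣ₘ-refl m
    step (no xm∉)  _         _         = via (xm m) xm∉ (n≤1+n i , ≤-refl , ≤-refl) refl
    step (yes _)   (no ym∉)  _         = via (ym m) ym∉ (≤-refl , n≤1+n j , ≤-refl) (cong (_+ l) (+-suc i j))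
    step (yes _)   (yes _)   (no zm∉)  = via (zm m) zm∉ (≤-refl , ≤-refl , n≤1+n l) (+-suc (i + j) l)

standard⇔Below-socles : ∀ gens {s₁ s₂} → Artinian gens → Socle gens s₁ → Socle gens s₂ →
  (∀ s → Socle gens s → s ≡ s₁ ⊎ s ≡ s₂) → ∀ m → Standard gens m ⇔ Below s₁ s₂ m
standard⇔Below-socles gens artinian socle₁ socle₂ only-two m = mk⇔ to from
  where
  to : Standard gens m → Below _ _ m
  to m∉ with s , socle , m∣s ← standard⇒∣ₘ-socle gens artinian m m∉ with only-two s socle
  ... | inj₁ refl = inj₁ m∣s
  ... | inj₂ refl = inj₂ m∣s
  from : Below _ _ m → Standard gens m
  from (inj₁ m∣s₁) = Standard-downward gens m∣s₁ (proj₁ socle₁)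
  from (inj₂ m∣s₂) = Standard-downward gens m∣s₂ (proj₁ socle₂)

monsOfDeg< : ℕ → List Mon
monsOfDeg< K = concatMap monsOfDeg (upTo K)

∈-monsOfDeg<⁺ : ∀ {K m} → deg m < K → m ∈ monsOfDeg< K
∈-monsOfDeg<⁺ {K} m< = ∈-concatMap⁺ monsOfDeg {xs = upTo K} (lose (∈-upTo⁺ m<) (∈-monsOfDeg⁺ refl))

monsOfDeg<-unique : ∀ K → Unique (monsOfDeg< K)
monsOfDeg<-unique K =
  Unique.concat⁺ (All.map⁺ (All.universal monsOfDeg-unique _)) (AllPairs.map⁺ (AllPairs.map degrees-disjoint (Unique.upTo⁺ K)))
  where
  degrees-disjoint : ∀ {d e} → d ≢ e → ∀ {m} → ¬ (m ∈ monsOfDeg d × m ∈ monsOfDeg e)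
  degrees-disjoint d≢e (m∈d , m∈e) = d≢e (trans (sym (∈-monsOfDeg⁻ m∈d)) (∈-monsOfDeg⁻ m∈e))

PureOSequence-cong : ∀ {h h′} → (∀ d → h d ≡ h′ d) → PureOSequence h′ → PureOSequence h
PureOSequence-cong h≗h′ (L , unique , closed , maximal , counts) = L , unique , closed , maximal , λ d → trans (h≗h′ d) (counts d)

MaximalIn-∣ₘ⇒≡ : ∀ {L m t} → MaximalIn L m → m ∣ₘ t → (∀ {n} → n ∣ₘ t → n ∈ L) → m ≡ t
MaximalIn-∣ₘ⇒≡ {m = i , j , l} {u , v , w} (_ , xm∉ , ym∉ , zm∉) (i≤ , j≤ , l≤) ↓t⊆L with i <? u | j <? v | l <? w
... | yes i< | _      | _      = ⊥-elim (xm∉ (↓t⊆L (i< , j≤ , l≤)))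
... | no _   | yes j< | _      = ⊥-elim (ym∉ (↓t⊆L (i≤ , j< , l≤)))
... | no _   | no _   | yes l< = ⊥-elim (zm∉ (↓t⊆L (i≤ , j≤ , l<)))
... | no i≮  | no j≮  | no l≮  rewrite ≤-antisym i≤ (≮⇒≥ i≮) | ≤-antisym j≤ (≮⇒≥ j≮) | ≤-antisym l≤ (≮⇒≥ l≮) = refl

below-pureOSequence : {S : Pred Mon 0ℓ} (S? : Decidable S) {t₁ t₂ : Mon} →
  (∀ n → S n ⇔ Below t₁ t₂ n) → deg t₁ ≡ deg t₂ → PureOSequence (count S?)
below-pureOSequence {S} S? {t₁} {t₂} S⇔ deg≡ =
  L , Unique.filter⁺ S? (monsOfDeg<-unique K) , closed , maximal , counts
  where
  K = suc (deg t₁ + deg t₂)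
  L = filter S? (monsOfDeg< K)
  ∈L : ∀ {m} → m ∈ L → S m
  ∈L m∈ = proj₂ (∈-filter⁻ S? {xs = monsOfDeg< K} m∈)
  below⇒∈L : ∀ m → Below t₁ t₂ m → m ∈ L
  below⇒∈L m below = ∈-filter⁺ S? (∈-monsOfDeg<⁺ (s≤s (deg≤ below))) (Equivalence.from (S⇔ m) below)
    where
    deg≤ : Below t₁ t₂ m → deg m ≤ deg t₁ + deg t₂
    deg≤ (inj₁ m∣t₁) = ≤-trans (∣ₘ⇒deg≤ m∣t₁) (m≤m+n (deg t₁) (deg t₂))
    deg≤ (inj₂ m∣t₂) = ≤-trans (∣ₘ⇒deg≤ m∣t₂) (m≤n+m (deg t₂) (deg t₁))
  closed : ∀ m n → n ∈ L → m ∣ₘ n → m ∈ L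
  closed m n n∈ m∣n with Equivalence.to (S⇔ n) (∈L n∈)
  ... | inj₁ n∣t₁ = below⇒∈L m (inj₁ (∣ₘ-trans m∣n n∣t₁))
  ... | inj₂ n∣t₂ = below⇒∈L m (inj₂ (∣ₘ-trans m∣n n∣t₂))
  deg-maximal : ∀ m → MaximalIn L m → deg m ≡ deg t₁
  deg-maximal m max with Equivalence.to (S⇔ m) (∈L (proj₁ max))
  ... | inj₁ m∣t₁ = cong deg (MaximalIn-∣ₘ⇒≡ max m∣t₁ (λ n∣t₁ → below⇒∈L _ (inj₁ n∣t₁)))
  ... | inj₂ m∣t₂ = trans (cong deg (MaximalIn-∣ₘ⇒≡ max m∣t₂ (λ n∣t₂ → below⇒∈L _ (inj₂ n∣t₂)))) (sym deg≡)
  maximal : ∀ m n → MaximalIn L m → MaximalIn L n → deg m ≡ deg n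
  maximal m n max-m max-n = trans (deg-maximal m max-m) (sym (deg-maximal n max-n))
  counts : ∀ d → count S? d ≡ length (filter (λ m → deg m ≟ d) L)
  counts d = length-≡-unique (Unique.filter⁺ S? (monsOfDeg-unique d))
                             (Unique.filter⁺ (λ m → deg m ≟ d) (Unique.filter⁺ S? (monsOfDeg<-unique K))) to from
    where
    to : ∀ {m} → m ∈ filter S? (monsOfDeg d) → m ∈ filter (λ m → deg m ≟ d) L
    to m∈ with m∈d , Sm ← ∈-filter⁻ S? {xs = monsOfDeg d} m∈ =
      ∈-filter⁺ (λ m → deg m ≟ d) (below⇒∈L _ (Equivalence.to (S⇔ _) Sm)) (∈-monsOfDeg⁻ m∈d)
    from : ∀ {m} → m ∈ filter (λ m → deg m ≟ d) L → m ∈ filter S? (monsOfDeg d)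
    from m∈ with m∈L , deg-m ← ∈-filter⁻ (λ m → deg m ≟ d) {xs = L} m∈ = ∈-filter⁺ S? (∈-monsOfDeg⁺ deg-m) (∈L m∈L)

-- The ideals (a) and (b)

Box : ℕ → ℕ → ℕ → Pred Mon 0ℓ
Box a b c m = proj₁ m < a × proj₁ (proj₂ m) < b × proj₂ (proj₂ m) < c

box? : ∀ a b c → Decidable (Box a b c)
box? a b c m = (proj₁ m <? a) ×-dec ((proj₁ (proj₂ m) <? b) ×-dec (proj₂ (proj₂ m) <? c))

∸-cancelʳ-<′ : ∀ {m n} o → m ∸ o < n ∸ o → m < n
∸-cancelʳ-<′ o m∸o<n∸o = ≰⇒> λ n≤m → <⇒≱ m∸o<n∸o (∸-monoˡ-≤ o n≤m)

BoxesA : ℕ → ℕ → ℕ → ℕ → ℕ → Pred Mon 0ℓ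
BoxesA a b c β γ m = Shifted (0 , β , 0) (Box a (b ∸ β) γ) m ⊎ Box a β c m

boxesA? : ∀ a b c β γ → Decidable (BoxesA a b c β γ)
boxesA? a b c β γ m = shifted? (0 , β , 0) (box? a (b ∸ β) γ) m ⊎-dec box? a β c m

standard-formA⇔boxesA : ∀ {a b c β γ} → β < b → γ < c → ∀ m → Standard (formA a b c β γ) m ⇔ BoxesA a b c β γ m
standard-formA⇔boxesA {a} {b} {c} {β} {γ} β<b γ<c m@(i , j , l) = mk⇔ to from
  where
  to : Standard (formA a b c β γ) m → BoxesA a b c β γ m
  to m∉ with β ≤? j
  ... | no β≰j  = inj₂ (i<a , ≰⇒> β≰j , ≰⇒> λ c≤l → m∉ (there (there (here (z≤n , z≤n , c≤l)))))
    where i<a = ≰⇒> λ a≤i → m∉ (here (a≤i , z≤n , z≤n))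
  ... | yes β≤j = inj₁ ((z≤n , β≤j , z≤n) , i<a , ∸-monoˡ-< j<b β≤j , ≰⇒> λ γ≤l → m∉ (there (there (there (here (z≤n , β≤j , γ≤l))))))
    where
    i<a = ≰⇒> λ a≤i → m∉ (here (a≤i , z≤n , z≤n))
    j<b = ≰⇒> λ b≤j → m∉ (there (here (z≤n , b≤j , z≤n)))
  from : BoxesA a b c β γ m → Standard (formA a b c β γ) m
  from (inj₁ ((_ , β≤j , _) , i<a , j∸β<b∸β , l<γ)) = All¬⇒¬Any
    ( (λ (a≤i , _) → <⇒≱ i<a a≤i)
    ∷ (λ (_ , b≤j , _) → <⇒≱ (∸-cancelʳ-<′ β j∸β<b∸β) b≤j)
    ∷ (λ (_ , _ , c≤l) → <⇒≱ (<-trans l<γ γ<c) c≤l)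
    ∷ (λ (_ , _ , γ≤l) → <⇒≱ l<γ γ≤l)
    ∷ [])
  from (inj₂ (i<a , j<β , l<c)) = All¬⇒¬Any
    ( (λ (a≤i , _) → <⇒≱ i<a a≤i)
    ∷ (λ (_ , b≤j , _) → <⇒≱ (<-trans j<β β<b) b≤j)
    ∷ (λ (_ , _ , c≤l) → <⇒≱ l<c c≤l)
    ∷ (λ (_ , β≤j , _) → <⇒≱ j<β β≤j)
    ∷ [])

HF-formA : ∀ a b c β γ → β < b → γ < c → ∀ d → HF (formA a b c β γ) d ≡ shift (H a (b ∸ β) γ) β d + H a β c d
HF-formA a b c β γ β<b γ<c d = begin
  HF (formA a b c β γ) d
    ≡⟨ count-cong (λ m → ¬? (inIdeal? (formA a b c β γ) m)) (boxesA? a b c β γ) (standard-formA⇔boxesA β<b γ<c) d ⟩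
  count (boxesA? a b c β γ) d
    ≡⟨ count-⊎ (shifted? (0 , β , 0) (box? a (b ∸ β) γ)) (box? a β c) disjoint d ⟩
  count (shifted? (0 , β , 0) (box? a (b ∸ β) γ)) d + H a β c d
    ≡⟨ cong (_+ H a β c d) (count-shifted (box? a (b ∸ β) γ) (0 , β , 0) d) ⟩
  shift (H a (b ∸ β) γ) (β + 0) d + H a β c d
    ≡⟨ cong (λ s → shift (H a (b ∸ β) γ) s d + H a β c d) (+-identityʳ β) ⟩
  shift (H a (b ∸ β) γ) β d + H a β c d
    ∎
  where
  open ≡-Reasoning
  disjoint : ∀ m → Shifted (0 , β , 0) (Box a (b ∸ β) γ) m → ¬ Box a β c m
  disjoint m ((_ , β≤j , _) , _) (_ , j<β , _) = <⇒≱ j<β β≤j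

boxesA⇔below : ∀ {p q₁ r₁ q₂ r₂} → r₁ < r₂ → ∀ m →
  BoxesA (suc p) (suc q₁) (suc r₂) (suc q₂) (suc r₁) m ⇔ Below (p , q₁ , r₁) (p , q₂ , r₂) m
boxesA⇔below {p} {q₁} {r₁} {q₂} {r₂} r₁<r₂ m@(i , j , l) = mk⇔ to from
  where
  to : BoxesA (suc p) (suc q₁) (suc r₂) (suc q₂) (suc r₁) m → Below (p , q₁ , r₁) (p , q₂ , r₂) m
  to (inj₁ ((_ , β≤j , _) , i<a , j∸β<b∸β , l<γ)) = inj₁ (s≤s⁻¹ i<a , s≤s⁻¹ (∸-cancelʳ-<′ (suc q₂) j∸β<b∸β) , s≤s⁻¹ l<γ)
  to (inj₂ (i<a , j<β , l<c)) = inj₂ (s≤s⁻¹ i<a , s≤s⁻¹ j<β , s≤s⁻¹ l<c)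
  from : Below (p , q₁ , r₁) (p , q₂ , r₂) m → BoxesA (suc p) (suc q₁) (suc r₂) (suc q₂) (suc r₁) m
  from (inj₂ (i≤p , j≤q₂ , l≤r₂)) = inj₂ (s≤s i≤p , s≤s j≤q₂ , s≤s l≤r₂)
  from (inj₁ (i≤p , j≤q₁ , l≤r₁)) with suc q₂ ≤? j
  ... | yes β≤j = inj₁ ((z≤n , β≤j , z≤n) , s≤s i≤p , ∸-monoˡ-< (s≤s j≤q₁) β≤j , s≤s l≤r₁)
  ... | no β≰j  = inj₂ (s≤s i≤p , ≰⇒> β≰j , s≤s (≤-trans l≤r₁ (<⇒≤ r₁<r₂)))

standard-formA⇔below : ∀ {p q₁ r₁ q₂ r₂} → q₂ < q₁ → r₁ < r₂ → ∀ m →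
  Standard (formA (suc p) (suc q₁) (suc r₂) (suc q₂) (suc r₁)) m ⇔ Below (p , q₁ , r₁) (p , q₂ , r₂) m
standard-formA⇔below q₂<q₁ r₁<r₂ m = ⇔.trans (standard-formA⇔boxesA (s≤s q₂<q₁) (s≤s r₁<r₂) m) (boxesA⇔below r₁<r₂ m)

BoxesB : ℕ → ℕ → ℕ → ℕ → ℕ → ℕ → Pred Mon 0ℓ
BoxesB a b c α β γ m = Shifted (α , 0 , 0) (Box (a ∸ α) β γ) m ⊎ Box α b c m

boxesB? : ∀ a b c α β γ → Decidable (BoxesB a b c α β γ)
boxesB? a b c α β γ m = shifted? (α , 0 , 0) (box? (a ∸ α) β γ) m ⊎-dec box? α b c m

standard-formB⇔boxesB : ∀ {a b c α β γ} → α < a → β < b → γ < c → ∀ m →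
  Standard (formB a b c α β γ) m ⇔ BoxesB a b c α β γ m
standard-formB⇔boxesB {a} {b} {c} {α} {β} {γ} α<a β<b γ<c m@(i , j , l) = mk⇔ to from
  where
  to : Standard (formB a b c α β γ) m → BoxesB a b c α β γ m
  to m∉ with α ≤? i
  ... | no α≰i  = inj₂ (≰⇒> α≰i , j<b , l<c)
    where
    j<b = ≰⇒> λ b≤j → m∉ (there (here (z≤n , b≤j , z≤n)))
    l<c = ≰⇒> λ c≤l → m∉ (there (there (here (z≤n , z≤n , c≤l))))
  ... | yes α≤i = inj₁ ((α≤i , z≤n , z≤n) , ∸-monoˡ-< i<a α≤i , j<β , l<γ)
    where
    i<a = ≰⇒> λ a≤i → m∉ (here (a≤i , z≤n , z≤n))
    j<β = ≰⇒> λ β≤j → m∉ (there (there (there (here (α≤i , β≤j , z≤n)))))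
    l<γ = ≰⇒> λ γ≤l → m∉ (there (there (there (there (here (α≤i , z≤n , γ≤l))))))
  from : BoxesB a b c α β γ m → Standard (formB a b c α β γ) m
  from (inj₁ (_ , i∸α<a∸α , j<β , l<γ)) = All¬⇒¬Any
    ( (λ (a≤i , _) → <⇒≱ (∸-cancelʳ-<′ α i∸α<a∸α) a≤i)
    ∷ (λ (_ , b≤j , _) → <⇒≱ (<-trans j<β β<b) b≤j)
    ∷ (λ (_ , _ , c≤l) → <⇒≱ (<-trans l<γ γ<c) c≤l)
    ∷ (λ (_ , β≤j , _) → <⇒≱ j<β β≤j)
    ∷ (λ (_ , _ , γ≤l) → <⇒≱ l<γ γ≤l)
    ∷ [])
  from (inj₂ (i<α , j<b , l<c)) = All¬⇒¬Any
    ( (λ (a≤i , _) → <⇒≱ (<-trans i<α α<a) a≤i)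
    ∷ (λ (_ , b≤j , _) → <⇒≱ j<b b≤j)
    ∷ (λ (_ , _ , c≤l) → <⇒≱ l<c c≤l)
    ∷ (λ (α≤i , _) → <⇒≱ i<α α≤i)
    ∷ (λ (α≤i , _) → <⇒≱ i<α α≤i)
    ∷ [])

HF-formB : ∀ a b c α β γ → α < a → β < b → γ < c → ∀ d →
  HF (formB a b c α β γ) d ≡ shift (H (a ∸ α) β γ) α d + H α b c d
HF-formB a b c α β γ α<a β<b γ<c d = begin
  HF (formB a b c α β γ) d
    ≡⟨ count-cong (λ m → ¬? (inIdeal? (formB a b c α β γ) m)) (boxesB? a b c α β γ) (standard-formB⇔boxesB α<a β<b γ<c) d ⟩
  count (boxesB? a b c α β γ) d
    ≡⟨ count-⊎ (shifted? (α , 0 , 0) (box? (a ∸ α) β γ)) (box? α b c) disjoint d ⟩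
  count (shifted? (α , 0 , 0) (box? (a ∸ α) β γ)) d + H α b c d
    ≡⟨ cong (_+ H α b c d) (count-shifted (box? (a ∸ α) β γ) (α , 0 , 0) d) ⟩
  shift (H (a ∸ α) β γ) (α + 0 + 0) d + H α b c d
    ≡⟨ cong (λ s → shift (H (a ∸ α) β γ) s d + H α b c d) (trans (+-identityʳ (α + 0)) (+-identityʳ α)) ⟩
  shift (H (a ∸ α) β γ) α d + H α b c d
    ∎
  where
  open ≡-Reasoning
  disjoint : ∀ m → Shifted (α , 0 , 0) (Box (a ∸ α) β γ) m → ¬ Box α b c m
  disjoint m ((α≤i , _) , _) (i<α , _) = <⇒≱ i<α α≤i

boxesB⇔below : ∀ {p₁ q₁ r₁ p₂ q₂ r₂} → q₂ < q₁ → r₂ < r₁ → ∀ m →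
  BoxesB (suc p₂) (suc q₁) (suc r₁) (suc p₁) (suc q₂) (suc r₂) m ⇔ Below (p₁ , q₁ , r₁) (p₂ , q₂ , r₂) m
boxesB⇔below {p₁} {q₁} {r₁} {p₂} {q₂} {r₂} q₂<q₁ r₂<r₁ m@(i , j , l) = mk⇔ to from
  where
  to : BoxesB (suc p₂) (suc q₁) (suc r₁) (suc p₁) (suc q₂) (suc r₂) m → Below (p₁ , q₁ , r₁) (p₂ , q₂ , r₂) m
  to (inj₁ (_ , i∸α<a∸α , j<β , l<γ)) = inj₂ (s≤s⁻¹ (∸-cancelʳ-<′ (suc p₁) i∸α<a∸α) , s≤s⁻¹ j<β , s≤s⁻¹ l<γ)
  to (inj₂ (i<α , j<b , l<c)) = inj₁ (s≤s⁻¹ i<α , s≤s⁻¹ j<b , s≤s⁻¹ l<c)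
  from : Below (p₁ , q₁ , r₁) (p₂ , q₂ , r₂) m → BoxesB (suc p₂) (suc q₁) (suc r₁) (suc p₁) (suc q₂) (suc r₂) m
  from (inj₁ (i≤p₁ , j≤q₁ , l≤r₁)) = inj₂ (s≤s i≤p₁ , s≤s j≤q₁ , s≤s l≤r₁)
  from (inj₂ (i≤p₂ , j≤q₂ , l≤r₂)) with suc p₁ ≤? i
  ... | yes α≤i = inj₁ ((α≤i , z≤n , z≤n) , ∸-monoˡ-< (s≤s i≤p₂) α≤i , s≤s j≤q₂ , s≤s l≤r₂)
  ... | no α≰i  = inj₂ (≰⇒> α≰i , s≤s (≤-trans j≤q₂ (<⇒≤ q₂<q₁)) , s≤s (≤-trans l≤r₂ (<⇒≤ r₂<r₁)))

standard-formB⇔below : ∀ {p₁ q₁ r₁ p₂ q₂ r₂} → p₁ < p₂ → q₂ < q₁ → r₂ < r₁ → ∀ m →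
  Standard (formB (suc p₂) (suc q₁) (suc r₁) (suc p₁) (suc q₂) (suc r₂)) m ⇔ Below (p₁ , q₁ , r₁) (p₂ , q₂ , r₂) m
standard-formB⇔below p₁<p₂ q₂<q₁ r₂<r₁ m =
  ⇔.trans (standard-formB⇔boxesB (s≤s p₁<p₂) (s≤s q₂<q₁) (s≤s r₂<r₁) m) (boxesB⇔below q₂<q₁ r₂<r₁ m)

-- Classification of the socle

≡⇔≡ : ∀ {x x′ y y′ : ℕ} → x ≡ x′ → y ≡ y′ → (x ≡ y) ⇔ (x′ ≡ y′)
≡⇔≡ refl refl = ⇔.refl

+≡+⇔∸≡∸ : ∀ {m n o p} → n ≤ m → o ≤ p → (m + o ≡ n + p) ⇔ (m ∸ n ≡ p ∸ o)
+≡+⇔∸≡∸ {m} {n} {o} {p} n≤m o≤p = mk⇔ to from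
  where
  open ≡-Reasoning
  to : m + o ≡ n + p → m ∸ n ≡ p ∸ o
  to eq = begin
    m ∸ n               ≡⟨ [m+n]∸[m+o]≡n∸o o m n ⟨
    (o + m) ∸ (o + n)   ≡⟨ cong₂ _∸_ (trans (+-comm o m) eq) (+-comm o n) ⟩
    (n + p) ∸ (n + o)   ≡⟨ [m+n]∸[m+o]≡n∸o n p o ⟩
    p ∸ o               ∎
  from : m ∸ n ≡ p ∸ o → m + o ≡ n + p
  from eq = begin
    m + o               ≡⟨ cong (_+ o) (m+[n∸m]≡n n≤m) ⟨
    n + (m ∸ n) + o     ≡⟨ +-assoc n (m ∸ n) o ⟩
    n + ((m ∸ n) + o)   ≡⟨ cong (λ k → n + (k + o)) eq ⟩
    n + ((p ∸ o) + o)   ≡⟨ cong (n +_) (m∸n+n≡m o≤p) ⟩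
    n + p               ∎

[m+n]∸[o+p]≡[m∸o]+[n∸p] : ∀ {m n o p} → o ≤ m → p ≤ n → (m + n) ∸ (o + p) ≡ (m ∸ o) + (n ∸ p)
[m+n]∸[o+p]≡[m∸o]+[n∸p] {m} {n} {o} {p} o≤m p≤n = begin
  (m + n) ∸ (o + p)   ≡⟨ ∸-+-assoc (m + n) o p ⟨
  (m + n) ∸ o ∸ p     ≡⟨ cong (_∸ p) (+-∸-comm n o≤m) ⟩
  (m ∸ o) + n ∸ p     ≡⟨ +-∸-assoc (m ∸ o) p≤n ⟩
  (m ∸ o) + (n ∸ p)   ∎
  where open ≡-Reasoning

deg≡⇔shapeA : ∀ {p q₁ r₁ q₂ r₂} → q₂ ≤ q₁ → r₁ ≤ r₂ →
  deg (p , q₁ , r₁) ≡ deg (p , q₂ , r₂) ⇔ (q₁ ∸ q₂ ≡ r₂ ∸ r₁)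
deg≡⇔shapeA {p} {q₁} {r₁} {q₂} {r₂} q₂≤q₁ r₁≤r₂ =
  ⇔.trans (≡⇔≡ (+-assoc p q₁ r₁) (+-assoc p q₂ r₂))
    (⇔.trans (mk⇔ (+-cancelˡ-≡ p _ _) (cong (p +_))) (+≡+⇔∸≡∸ q₂≤q₁ r₁≤r₂))

deg≡⇔shapeB : ∀ {p₁ q₁ r₁ p₂ q₂ r₂} → p₁ ≤ p₂ → q₂ ≤ q₁ → r₂ ≤ r₁ →
  deg (p₁ , q₁ , r₁) ≡ deg (p₂ , q₂ , r₂) ⇔ (p₂ ∸ p₁ ≡ (q₁ ∸ q₂) + (r₁ ∸ r₂))
deg≡⇔shapeB {p₁} {q₁} {r₁} {p₂} {q₂} {r₂} p₁≤p₂ q₂≤q₁ r₂≤r₁ =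
  ⇔.trans (≡⇔≡ (rotate p₁ q₁ r₁) (rotate p₂ q₂ r₂))
    (⇔.trans (+≡+⇔∸≡∸ (+-mono-≤ q₂≤q₁ r₂≤r₁) p₁≤p₂)
      (⇔.trans (≡⇔≡ ([m+n]∸[o+p]≡[m∸o]+[n∸p] q₂≤q₁ r₂≤r₁) refl) (mk⇔ sym sym)))
  where
  rotate : ∀ p q r → p + q + r ≡ q + r + p
  rotate p q r = trans (+-assoc p q r) (+-comm p (q + r))

data SocleShape : Mon → Mon → Set where
  shapeA : ∀ {p q₁ r₁ q₂ r₂} → q₂ < q₁ → r₁ < r₂ → SocleShape (p , q₁ , r₁) (p , q₂ , r₂)
  shapeB : ∀ {p₁ q₁ r₁ p₂ q₂ r₂} → p₁ < p₂ → q₂ < q₁ → r₂ < r₁ → SocleShape (p₁ , q₁ , r₁) (p₂ , q₂ , r₂)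

PairImage : Perm3 → Mon → Mon → Mon → Mon → Set
PairImage σ t₁ t₂ s₁ s₂ = (perm σ t₁ ≡ s₁ × perm σ t₂ ≡ s₂) ⊎ (perm σ t₁ ≡ s₂ × perm σ t₂ ≡ s₁)

PairImage-deg : ∀ {σ t₁ t₂ s₁ s₂} → PairImage σ t₁ t₂ s₁ s₂ → deg s₁ ≡ deg s₂ → deg t₁ ≡ deg t₂
PairImage-deg {σ} {t₁} {t₂} (inj₁ (refl , refl)) deg≡ = trans (sym (deg-perm σ t₁)) (trans deg≡ (deg-perm σ t₂))
PairImage-deg {σ} {t₁} {t₂} (inj₂ (refl , refl)) deg≡ = trans (sym (deg-perm σ t₁)) (trans (sym deg≡) (deg-perm σ t₂))

PairImage-below : ∀ {σ t₁ t₂ s₁ s₂} → PairImage σ t₁ t₂ s₁ s₂ → ∀ n → Below s₁ s₂ (perm σ n) ⇔ Below t₁ t₂ n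
PairImage-below {σ} {t₁} {t₂} (inj₁ (refl , refl)) n = Below-perm σ t₁ t₂ n
PairImage-below {σ} {t₁} {t₂} (inj₂ (refl , refl)) n = ⇔.trans (Below-swap _ _ (perm σ n)) (Below-perm σ t₁ t₂ n)

-- The 15 sign patterns of comparable monomials are excluded by incomparable; each of the other 12
-- is shapeA or shapeB after permuting the variables and possibly swapping s₁ and s₂.
classify : ∀ s₁ s₂ → deg s₁ ≡ deg s₂ → s₁ ≢ s₂ →
  Σ Perm3 λ σ → Σ Mon λ t₁ → Σ Mon λ t₂ → SocleShape t₁ t₂ × PairImage σ t₁ t₂ s₁ s₂
classify (p₁ , q₁ , r₁) (p₂ , q₂ , r₂) deg≡ s₁≢s₂ with <-cmp p₁ p₂ | <-cmp q₁ q₂ | <-cmp r₁ r₂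
... | tri< p< _ _    | tri< q< _ _    | tri< r< _ _    = ⊥-elim (incomparable deg≡ s₁≢s₂ (inj₁ (<⇒≤ p< , <⇒≤ q< , <⇒≤ r<)))
... | tri< p< _ _    | tri< q< _ _    | tri≈ _ refl _  = ⊥-elim (incomparable deg≡ s₁≢s₂ (inj₁ (<⇒≤ p< , <⇒≤ q< , ≤-refl)))
... | tri< p< _ _    | tri< q< _ _    | tri> _ _ r>    = pyzx , _ , _ , shapeB r> p< q< , inj₂ (refl , refl)
... | tri< p< _ _    | tri≈ _ refl _  | tri< r< _ _    = ⊥-elim (incomparable deg≡ s₁≢s₂ (inj₁ (<⇒≤ p< , ≤-refl , <⇒≤ r<)))
... | tri< p< _ _    | tri≈ _ refl _  | tri≈ _ refl _  = ⊥-elim (incomparable deg≡ s₁≢s₂ (inj₁ (<⇒≤ p< , ≤-refl , ≤-refl)))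
... | tri< p< _ _    | tri≈ _ refl _  | tri> _ _ r>    = pyxz , _ , _ , shapeA p< r> , inj₂ (refl , refl)
... | tri< p< _ _    | tri> _ _ q>    | tri< r< _ _    = pyxz , _ , _ , shapeB q> p< r< , inj₂ (refl , refl)
... | tri< p< _ _    | tri> _ _ q>    | tri≈ _ refl _  = pyzx , _ , _ , shapeA p< q> , inj₂ (refl , refl)
... | tri< p< _ _    | tri> _ _ q>    | tri> _ _ r>    = pxyz , _ , _ , shapeB p< q> r> , inj₁ (refl , refl)
... | tri≈ _ refl _  | tri< q< _ _    | tri< r< _ _    = ⊥-elim (incomparable deg≡ s₁≢s₂ (inj₁ (≤-refl , <⇒≤ q< , <⇒≤ r<)))
... | tri≈ _ refl _  | tri< q< _ _    | tri≈ _ refl _  = ⊥-elim (incomparable deg≡ s₁≢s₂ (inj₁ (≤-refl , <⇒≤ q< , ≤-refl)))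
... | tri≈ _ refl _  | tri< q< _ _    | tri> _ _ r>    = pxyz , _ , _ , shapeA q< r> , inj₂ (refl , refl)
... | tri≈ _ refl _  | tri≈ _ refl _  | tri< r< _ _    = ⊥-elim (incomparable deg≡ s₁≢s₂ (inj₁ (≤-refl , ≤-refl , <⇒≤ r<)))
... | tri≈ _ refl _  | tri≈ _ refl _  | tri≈ _ refl _  = ⊥-elim (s₁≢s₂ refl)
... | tri≈ _ refl _  | tri≈ _ refl _  | tri> _ _ r>    = ⊥-elim (incomparable deg≡ s₁≢s₂ (inj₂ (≤-refl , ≤-refl , <⇒≤ r>)))
... | tri≈ _ refl _  | tri> _ _ q>    | tri< r< _ _    = pxyz , _ , _ , shapeA q> r< , inj₁ (refl , refl)
... | tri≈ _ refl _  | tri> _ _ q>    | tri≈ _ refl _  = ⊥-elim (incomparable deg≡ s₁≢s₂ (inj₂ (≤-refl , <⇒≤ q> , ≤-refl)))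
... | tri≈ _ refl _  | tri> _ _ q>    | tri> _ _ r>    = ⊥-elim (incomparable deg≡ s₁≢s₂ (inj₂ (≤-refl , <⇒≤ q> , <⇒≤ r>)))
... | tri> _ _ p>    | tri< q< _ _    | tri< r< _ _    = pxyz , _ , _ , shapeB p> q< r< , inj₂ (refl , refl)
... | tri> _ _ p>    | tri< q< _ _    | tri≈ _ refl _  = pyzx , _ , _ , shapeA p> q< , inj₁ (refl , refl)
... | tri> _ _ p>    | tri< q< _ _    | tri> _ _ r>    = pyxz , _ , _ , shapeB q< p> r> , inj₁ (refl , refl)
... | tri> _ _ p>    | tri≈ _ refl _  | tri< r< _ _    = pyxz , _ , _ , shapeA p> r< , inj₁ (refl , refl)
... | tri> _ _ p>    | tri≈ _ refl _  | tri≈ _ refl _  = ⊥-elim (incomparable deg≡ s₁≢s₂ (inj₂ (<⇒≤ p> , ≤-refl , ≤-refl)))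
... | tri> _ _ p>    | tri≈ _ refl _  | tri> _ _ r>    = ⊥-elim (incomparable deg≡ s₁≢s₂ (inj₂ (<⇒≤ p> , ≤-refl , <⇒≤ r>)))
... | tri> _ _ p>    | tri> _ _ q>    | tri< r< _ _    = pyzx , _ , _ , shapeB r< p> q> , inj₁ (refl , refl)
... | tri> _ _ p>    | tri> _ _ q>    | tri≈ _ refl _  = ⊥-elim (incomparable deg≡ s₁≢s₂ (inj₂ (<⇒≤ p> , <⇒≤ q> , ≤-refl)))
... | tri> _ _ p>    | tri> _ _ q>    | tri> _ _ r>    = ⊥-elim (incomparable deg≡ s₁≢s₂ (inj₂ (<⇒≤ p> , <⇒≤ q> , <⇒≤ r>)))

Standard⇔⇒SameIdeal : ∀ {F G} → (∀ m → Standard F m ⇔ Standard G m) → SameIdeal F G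
Standard⇔⇒SameIdeal {F} {G} F⇔G m = mk⇔
  (λ m∈F → decidable-stable (inIdeal? G m) λ m∉G → Equivalence.from (F⇔G m) m∉G m∈F)
  (λ m∈G → decidable-stable (inIdeal? F m) λ m∉F → Equivalence.to (F⇔G m) m∉F m∈G)

SameIdeal-perm : ∀ gens F σ {s₁ s₂ t₁ t₂} →
  (∀ m → Standard gens m ⇔ Below s₁ s₂ m) → (∀ n → Standard F n ⇔ Below t₁ t₂ n) →
  (∀ n → Below s₁ s₂ (perm σ n) ⇔ Below t₁ t₂ n) → SameIdeal gens (map (perm σ) F)
SameIdeal-perm gens F σ standard-gens standard-F below-perm =
  Standard⇔⇒SameIdeal λ m → subst (λ m → Standard gens m ⇔ Standard (map (perm σ) F) m) (perm-inverseʳ σ m)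
    (at-image (perm (inverse σ) m))
  where
  at-image : ∀ n → Standard gens (perm σ n) ⇔ Standard (map (perm σ) F) (perm σ n)
  at-image n =
    ⇔.trans (standard-gens (perm σ n))
      (⇔.trans (below-perm n)
        (⇔.trans (⇔.sym (standard-F n))
          (mk⇔ (λ n∉F σn∈ → n∉F (Equivalence.to (InIdeal-perm σ F n) σn∈))
               (λ σn∉ n∈F → σn∉ (Equivalence.from (InIdeal-perm σ F n) n∈F)))))

HF-transfer : ∀ {gens F σ} {h : ℕ → ℕ} → SameIdeal gens (map (perm σ) F) → (∀ d → HF F d ≡ h d) → ∀ d → HF gens d ≡ h d
HF-transfer {F = F} {σ} same HF-F d = trans (SameIdeal⇒HF≡ same d) (trans (HF-perm σ F d) (HF-F d))

IsFormA : List Mon → Perm3 → Set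
IsFormA gens σ = Σ ℕ λ a → Σ ℕ λ b → Σ ℕ λ c → Σ ℕ λ β → Σ ℕ λ γ →
  (0 < a) × (0 < β) × (β < b) × (0 < γ) × (γ < c) × (b ∸ β ≡ c ∸ γ) ×
  SameIdeal gens (map (perm σ) (formA a b c β γ)) ×
  (∀ d → HF gens d ≡ shift (H a (b ∸ β) γ) β d + H a β c d)

IsFormB : List Mon → Perm3 → Set
IsFormB gens σ = Σ ℕ λ a → Σ ℕ λ b → Σ ℕ λ c → Σ ℕ λ α → Σ ℕ λ β → Σ ℕ λ γ →
  (0 < α) × (α < a) × (0 < β) × (β < b) × (0 < γ) × (γ < c) ×
  (a ∸ α ≡ (b ∸ β) + (c ∸ γ)) ×
  SameIdeal gens (map (perm σ) (formB a b c α β γ)) ×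
  (∀ d → HF gens d ≡ shift (H (a ∸ α) β γ) α d + H α b c d)

level-type2-classification : (gens : List Mon) → ArtinianLevelType2 gens → Σ Perm3 λ σ → IsFormA gens σ ⊎ IsFormB gens σ
level-type2-classification gens (artinian , s₁ , s₂ , s₁≢s₂ , socle₁ , socle₂ , deg≡ , only-two)
  with classify s₁ s₂ deg≡ s₁≢s₂
... | σ , _ , _ , shapeA {p} {q₁} {r₁} {q₂} {r₂} q₂<q₁ r₁<r₂ , image =
  σ , inj₁ (suc p , suc q₁ , suc r₂ , suc q₂ , suc r₁ , s≤s z≤n , s≤s z≤n , s≤s q₂<q₁ , s≤s z≤n , s≤s r₁<r₂ ,
            Equivalence.to (deg≡⇔shapeA (<⇒≤ q₂<q₁) (<⇒≤ r₁<r₂)) (PairImage-deg image deg≡) ,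
            same , HF-transfer same (HF-formA (suc p) (suc q₁) (suc r₂) (suc q₂) (suc r₁) (s≤s q₂<q₁) (s≤s r₁<r₂)))
  where
  same = SameIdeal-perm gens _ σ (standard⇔Below-socles gens artinian socle₁ socle₂ only-two)
           (standard-formA⇔below q₂<q₁ r₁<r₂) (PairImage-below image)
... | σ , _ , _ , shapeB {p₁} {q₁} {r₁} {p₂} {q₂} {r₂} p₁<p₂ q₂<q₁ r₂<r₁ , image =
  σ , inj₂ (suc p₂ , suc q₁ , suc r₁ , suc p₁ , suc q₂ , suc r₂ ,
            s≤s z≤n , s≤s p₁<p₂ , s≤s z≤n , s≤s q₂<q₁ , s≤s z≤n , s≤s r₂<r₁ ,
            Equivalence.to (deg≡⇔shapeB (<⇒≤ p₁<p₂) (<⇒≤ q₂<q₁) (<⇒≤ r₂<r₁)) (PairImage-deg image deg≡) ,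
            same , HF-transfer same (HF-formB (suc p₂) (suc q₁) (suc r₁) (suc p₁) (suc q₂) (suc r₂) (s≤s p₁<p₂) (s≤s q₂<q₁) (s≤s r₂<r₁)))
  where
  same = SameIdeal-perm gens _ σ (standard⇔Below-socles gens artinian socle₁ socle₂ only-two)
           (standard-formB⇔below p₁<p₂ q₂<q₁ r₂<r₁) (PairImage-below image)

formA-pureOSequence : (a b c β γ : ℕ) → 0 < a → 0 < β → β < b → 0 < γ → γ < c → b ∸ β ≡ c ∸ γ →
  PureOSequence (λ d → shift (H a (b ∸ β) γ) β d + H a β c d)
formA-pureOSequence (suc p) (suc q₁) (suc r₂) (suc q₂) (suc r₁) (s≤s z≤n) (s≤s z≤n) (s≤s q₂<q₁) (s≤s z≤n) (s≤s r₁<r₂) ∸≡ =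
  PureOSequence-cong (λ d → sym (HF-formA (suc p) (suc q₁) (suc r₂) (suc q₂) (suc r₁) (s≤s q₂<q₁) (s≤s r₁<r₂) d))
    (below-pureOSequence (λ m → ¬? (inIdeal? (formA (suc p) (suc q₁) (suc r₂) (suc q₂) (suc r₁)) m))
      (standard-formA⇔below q₂<q₁ r₁<r₂) (Equivalence.from (deg≡⇔shapeA (<⇒≤ q₂<q₁) (<⇒≤ r₁<r₂)) ∸≡))

formB-pureOSequence : (a b c α β γ : ℕ) → 0 < α → α < a → 0 < β → β < b → 0 < γ → γ < c →
  a ∸ α ≡ (b ∸ β) + (c ∸ γ) → PureOSequence (λ d → shift (H (a ∸ α) β γ) α d + H α b c d)
formB-pureOSequence (suc p₂) (suc q₁) (suc r₁) (suc p₁) (suc q₂) (suc r₂)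
                    (s≤s z≤n) (s≤s p₁<p₂) (s≤s z≤n) (s≤s q₂<q₁) (s≤s z≤n) (s≤s r₂<r₁) ∸≡ =
  PureOSequence-cong (λ d → sym (HF-formB (suc p₂) (suc q₁) (suc r₁) (suc p₁) (suc q₂) (suc r₂) (s≤s p₁<p₂) (s≤s q₂<q₁) (s≤s r₂<r₁) d))
    (below-pureOSequence (λ m → ¬? (inIdeal? (formB (suc p₂) (suc q₁) (suc r₁) (suc p₁) (suc q₂) (suc r₂)) m))
      (standard-formB⇔below p₁<p₂ q₂<q₁ r₂<r₁)
      (Equivalence.from (deg≡⇔shapeB (<⇒≤ p₁<p₂) (<⇒≤ q₂<q₁) (<⇒≤ r₂<r₁)) ∸≡))

proposition6p1 :
  ((gens : List Mon) → ArtinianLevelType2 gens →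
    Σ Perm3 λ σ →
      (Σ ℕ λ a → Σ ℕ λ b → Σ ℕ λ c → Σ ℕ λ β → Σ ℕ λ γ →
        (0 < a) × (0 < β) × (β < b) × (0 < γ) × (γ < c) × (b ∸ β ≡ c ∸ γ) ×
        SameIdeal gens (map (perm σ) (formA a b c β γ)) ×
        (∀ d → HF gens d ≡ shift (H a (b ∸ β) γ) β d + H a β c d))
      ⊎
      (Σ ℕ λ a → Σ ℕ λ b → Σ ℕ λ c → Σ ℕ λ α → Σ ℕ λ β → Σ ℕ λ γ →
        (0 < α) × (α < a) × (0 < β) × (β < b) × (0 < γ) × (γ < c) ×
        (a ∸ α ≡ (b ∸ β) + (c ∸ γ)) ×
        SameIdeal gens (map (perm σ) (formB a b c α β γ)) ×
        (∀ d → HF gens d ≡ shift (H (a ∸ α) β γ) α d + H α b c d)))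
  ×
  ((a b c β γ : ℕ) → 0 < a → 0 < β → β < b → 0 < γ → γ < c → b ∸ β ≡ c ∸ γ →
    PureOSequence (λ d → shift (H a (b ∸ β) γ) β d + H a β c d))
  ×
  ((a b c α β γ : ℕ) → 0 < α → α < a → 0 < β → β < b → 0 < γ → γ < c →
    a ∸ α ≡ (b ∸ β) + (c ∸ γ) →
    PureOSequence (λ d → shift (H (a ∸ α) β γ) α d + H α b c d))
proposition6p1 = level-type2-classification , formA-pureOSequence , formB-pureOSequence
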